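{- Let $D=(d_1,\ldots,d_n)$ be a forcibly unicyclic graphic sequence (written in non-increasing order). (1) If $n=3$, then $D=(2,2,2)$. (2) If $n=4$, then $D=(2,2,2,2)$ or $D=(3,2,2,1)$. (3) If $n=5$, then $D=(2,2,2,2,2)$, or $D=(3,2,2,2,1)$, or $D=(3,3,2,1,1)$, or $D=(4,2,2,1,1)$.
   Context: All graphs are simple. A realization of a sequence $D=(d_1,\ldots,d_n)$ is a simple graph with vertices $v_1,\ldots,v_n$ with $\deg(v_i)=d_i$; $D$ is graphic if it has a realization. A graphic sequence is forcibly unicyclic if every realization of it is connected and has exactly $n$ edges. -}

module Defs where

open import Data.Nat using (ℕ; zero; suc; _+_; _≤_; _<ᵇ_)
open import Data.Bool using (Bool; true; false; _∧_; if_then_else_)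
open import Data.Fin using (Fin; toℕ) renaming (zero to fzero; suc to fsuc)
open import Data.Fin using () renaming (_≤_ to _≤ᶠ_)
open import Data.Vec using (Vec; lookup)
open import Data.Product using (Σ; _×_)
open import Relation.Binary.PropositionalEquality using (_≡_)

sumFin : ∀ {n} → (Fin n → ℕ) → ℕ
sumFin {zero}  f = 0
sumFin {suc n} f = f fzero + sumFin (λ i → f (fsuc i))

count : ∀ {n} → (Fin n → Bool) → ℕ
count p = sumFin (λ i → if p i then 1 else 0)

record Graph (n : ℕ) : Set where
  field
    adj    : Fin n → Fin n → Bool
    sym    : ∀ i j → adj i j ≡ adj j i
    irrefl : ∀ i → adj i i ≡ false
open Graph public

deg : ∀ {n} → Graph n → Fin n → ℕ
deg G i = count (λ j → adj G i j)

edges : ∀ {n} → Graph n → ℕ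
edges G = sumFin (λ i → count (λ j → (toℕ i <ᵇ toℕ j) ∧ adj G i j))

data Reach {n} (G : Graph n) : Fin n → Fin n → Set where
  here : ∀ {i} → Reach G i i
  step : ∀ {i j k} → adj G i j ≡ true → Reach G j k → Reach G i k

Connected : ∀ {n} → Graph n → Set
Connected G = ∀ i j → Reach G i j

Realizes : ∀ {n} → Graph n → Vec ℕ n → Set
Realizes G D = ∀ i → deg G i ≡ lookup D i

Graphic : ∀ {n} → Vec ℕ n → Set
Graphic {n} D = Σ (Graph n) (λ G → Realizes G D)

ForciblyUnicyclic : ∀ {n} → Vec ℕ n → Set
ForciblyUnicyclic {n} D =
  Graphic D × (∀ (G : Graph n) → Realizes G D → Connected G × edges G ≡ n)

NonIncreasing : ∀ {n} → Vec ℕ n → Set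
NonIncreasing D = ∀ i j → i ≤ᶠ j → lookup D j ≤ lookup D i

-- A forcibly unicyclic sequence D has a realization, and that realization is
-- connected with n edges; for n ≥ 2 connectivity forces every degree to be
-- positive. So D is the degree sequence of a graph with n edges and no
-- isolated vertex, and enumerating all graphs on 3, 4 and 5 vertices shows
-- that the non-increasing such sequences are among the listed ones.
module Submission where

open import Defs
open import Data.Nat using (ℕ; zero; suc; _+_; _<_; _<ᵇ_; _≟_; _≤?_; _<?_; z≤n; s≤s)
open import Data.Nat.Properties using (≤-trans; m≤n+m)
open import Data.Bool using (Bool; true; false; _∧_; if_then_else_)
open import Data.Fin using (Fin; toℕ; punchIn) renaming (zero to fzero; suc to fsuc)
open import Data.Fin.Properties using (all?; punchInᵢ≢i) renaming (_≤?_ to _≤ᶠ?_)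
open import Data.Vec using (Vec; []; _∷_; lookup; tabulate)
open import Data.Vec.Properties using (lookup∘tabulate; tabulate∘lookup; tabulate-cong)
import Data.Vec.Properties as Vec
open import Data.List using (List) renaming ([] to []ᴸ; _∷_ to _∷ᴸ_)
open import Data.List.Relation.Unary.Any using (here; there; any?)
open import Data.List.Membership.Propositional using (_∈_)
open import Data.Unit using (⊤; tt)
open import Data.Product using (_×_; _,_)
open import Data.Sum using (_⊎_; inj₁; inj₂)
open import Function using (_∘_)
open import Relation.Nullary using (Dec; contradiction)
open import Relation.Nullary.Decidable using (True; toWitness; map′; _×-dec_; _→-dec_)
open import Relation.Unary using (Decidable)
open import Relation.Binary.PropositionalEquality
  using (_≡_; _≢_; _≗_; refl; trans; cong; cong₂; subst)
  renaming (sym to ≡-sym)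

private
  variable
    n : ℕ

sumFin-cong : {f g : Fin n → ℕ} → f ≗ g → sumFin f ≡ sumFin g
sumFin-cong {zero}  f≗g = refl
sumFin-cong {suc n} f≗g = cong₂ _+_ (f≗g fzero) (sumFin-cong (f≗g ∘ fsuc))

count-cong : {p q : Fin n → Bool} → p ≗ q → count p ≡ count q
count-cong p≗q = sumFin-cong (cong (λ b → if b then 1 else 0) ∘ p≗q)

0<count : {p : Fin n → Bool} (i : Fin n) → p i ≡ true → 0 < count p
0<count fzero pi≡true rewrite pi≡true = s≤s z≤n
0<count {p = p} (fsuc i) pi≡true =
  ≤-trans (0<count i pi≡true) (m≤n+m _ (if p fzero then 1 else 0))

SameAdjacency : Graph n → Graph n → Set
SameAdjacency G H = ∀ i j → adj G i j ≡ adj H i j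

deg-cong : (G H : Graph n) → SameAdjacency G H → deg G ≗ deg H
deg-cong G H G≈H i = count-cong (G≈H i)

edges-cong : (G H : Graph n) → SameAdjacency G H → edges G ≡ edges H
edges-cong G H G≈H = sumFin-cong λ i → count-cong λ j → cong ((toℕ i <ᵇ toℕ j) ∧_) (G≈H i j)

Reach⇒0<deg : {G : Graph n} {i j : Fin n} → Reach G i j → i ≢ j → 0 < deg G i
Reach⇒0<deg here            i≢i = contradiction refl i≢i
Reach⇒0<deg (step {j = k} e _) _ = 0<count k e

Connected⇒0<deg : (G : Graph (suc (suc n))) → Connected G → ∀ i → 0 < deg G i
Connected⇒0<deg G conn i = Reach⇒0<deg (conn i (punchIn i fzero)) (punchInᵢ≢i i fzero ∘ ≡-sym)

degrees : Graph n → Vec ℕ n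
degrees G = tabulate (deg G)

Realizes⇒degrees≡ : (G : Graph n) {D : Vec ℕ n} → Realizes G D → degrees G ≡ D
Realizes⇒degrees≡ G {D} real = trans (tabulate-cong real) (tabulate∘lookup D)

nonIncreasing? : (D : Vec ℕ n) → Dec (NonIncreasing D)
nonIncreasing? D = all? λ i → all? λ j → (i ≤ᶠ? j) →-dec (lookup D j ≤? lookup D i)

-- Codes of graphs: the adjacency row from vertex 0 to the later vertices,
-- followed by the code of the graph on the remaining vertices.
Code : ℕ → Set
Code zero    = ⊤
Code (suc n) = Vec Bool n × Code n

codeAdj : Code n → Fin n → Fin n → Bool
codeAdj {suc n} (r , c) fzero    fzero    = false
codeAdj {suc n} (r , c) fzero    (fsuc j) = lookup r j
codeAdj {suc n} (r , c) (fsuc i) fzero    = lookup r i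
codeAdj {suc n} (r , c) (fsuc i) (fsuc j) = codeAdj c i j

codeAdj-sym : (c : Code n) → ∀ i j → codeAdj c i j ≡ codeAdj c j i
codeAdj-sym {suc n} (r , c) fzero    fzero    = refl
codeAdj-sym {suc n} (r , c) fzero    (fsuc j) = refl
codeAdj-sym {suc n} (r , c) (fsuc i) fzero    = refl
codeAdj-sym {suc n} (r , c) (fsuc i) (fsuc j) = codeAdj-sym c i j

codeAdj-irrefl : (c : Code n) → ∀ i → codeAdj c i i ≡ false
codeAdj-irrefl {suc n} (r , c) fzero    = refl
codeAdj-irrefl {suc n} (r , c) (fsuc i) = codeAdj-irrefl c i

decode : Code n → Graph n
decode c = record { adj = codeAdj c ; sym = codeAdj-sym c ; irrefl = codeAdj-irrefl c }

deleteVertex₀ : Graph (suc n) → Graph n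
deleteVertex₀ G = record
  { adj    = λ i j → adj G (fsuc i) (fsuc j)
  ; sym    = λ i j → Graph.sym G (fsuc i) (fsuc j)
  ; irrefl = irrefl G ∘ fsuc
  }

encode : Graph n → Code n
encode {zero}  G = tt
encode {suc n} G = tabulate (adj G fzero ∘ fsuc) , encode (deleteVertex₀ G)

decode-encode : (G : Graph n) → SameAdjacency (decode (encode G)) G
decode-encode {suc n} G fzero    fzero    = ≡-sym (irrefl G fzero)
decode-encode {suc n} G fzero    (fsuc j) = lookup∘tabulate (adj G fzero ∘ fsuc) j
decode-encode {suc n} G (fsuc i) fzero    =
  trans (lookup∘tabulate (adj G fzero ∘ fsuc) i) (Graph.sym G fzero (fsuc i))
decode-encode {suc n} G (fsuc i) (fsuc j) = decode-encode (deleteVertex₀ G) i j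

∀-Vec-Bool? : {P : Vec Bool n → Set} → Decidable P → Dec (∀ v → P v)
∀-Vec-Bool? {zero}  P? = map′ (λ { p [] → p }) (λ ∀p → ∀p []) (P? [])
∀-Vec-Bool? {suc n} P? =
  map′ (λ { (∀p , _) (true ∷ v) → ∀p v ; (_ , ∀p) (false ∷ v) → ∀p v })
       (λ ∀p → (∀p ∘ (true ∷_)) , (∀p ∘ (false ∷_)))
       (∀-Vec-Bool? (P? ∘ (true ∷_)) ×-dec ∀-Vec-Bool? (P? ∘ (false ∷_)))

∀-Code? : {P : Code n → Set} → Decidable P → Dec (∀ c → P c)
∀-Code? {zero}  P? = map′ (λ { p tt → p }) (λ ∀p → ∀p tt) (P? tt)
∀-Code? {suc n} P? =
  map′ (λ { ∀p (r , c) → ∀p r c }) (λ ∀p r c → ∀p (r , c))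
       (∀-Vec-Bool? λ r → ∀-Code? λ c → P? (r , c))

-- The implicit argument is discharged by the type checker evaluating the
-- decision procedure on all 2^(n choose 2) codes.
∀-Graph : {P : Graph n → Set} (P? : Decidable P) →
          (∀ G H → SameAdjacency G H → P G → P H) →
          {True (∀-Code? (P? ∘ decode))} → ∀ G → P G
∀-Graph P? P-cong {allCodes} G =
  P-cong (decode (encode G)) G (decode-encode G) (toWitness allCodes (encode G))

UnicyclicDegreesIn : List (Vec ℕ n) → Graph n → Set
UnicyclicDegreesIn {n} Ds G =
  NonIncreasing (degrees G) → (∀ i → 0 < deg G i) → edges G ≡ n → degrees G ∈ Ds

unicyclicDegreesIn? : (Ds : List (Vec ℕ n)) → Decidable (UnicyclicDegreesIn Ds)
unicyclicDegreesIn? {n} Ds G =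
  nonIncreasing? (degrees G) →-dec (all? λ i → 0 <? deg G i)
    →-dec (edges G ≟ n) →-dec any? (Vec.≡-dec _≟_ (degrees G)) Ds

UnicyclicDegreesIn-cong : (Ds : List (Vec ℕ n)) (G H : Graph n) → SameAdjacency G H →
                          UnicyclicDegreesIn Ds G → UnicyclicDegreesIn Ds H
UnicyclicDegreesIn-cong Ds G H G≈H inG niH posH edgesH =
  subst (_∈ Ds) degrees≡ (inG niG posG (trans (edges-cong G H G≈H) edgesH))
  where
    degrees≡ : degrees G ≡ degrees H
    degrees≡ = tabulate-cong (deg-cong G H G≈H)

    niG : NonIncreasing (degrees G)
    niG = subst NonIncreasing (≡-sym degrees≡) niH

    posG : ∀ i → 0 < deg G i
    posG i = subst (0 <_) (≡-sym (deg-cong G H G≈H i)) (posH i)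

forciblyUnicyclic⇒∈ : (Ds : List (Vec ℕ (suc (suc n)))) →
                      (∀ G → UnicyclicDegreesIn Ds G) →
                      ∀ D → NonIncreasing D → ForciblyUnicyclic D → D ∈ Ds
forciblyUnicyclic⇒∈ Ds allG D ni ((G , real) , forced) with forced G real
... | conn , edges≡n =
  subst (_∈ Ds) degrees≡D
    (allG G (subst NonIncreasing (≡-sym degrees≡D) ni) (Connected⇒0<deg G conn) edges≡n)
  where
    degrees≡D : degrees G ≡ D
    degrees≡D = Realizes⇒degrees≡ G real

candidates₃ : List (Vec ℕ 3)
candidates₃ = (2 ∷ 2 ∷ 2 ∷ []) ∷ᴸ []ᴸ

candidates₄ : List (Vec ℕ 4)
candidates₄ = (2 ∷ 2 ∷ 2 ∷ 2 ∷ []) ∷ᴸ (3 ∷ 2 ∷ 2 ∷ 1 ∷ []) ∷ᴸ []ᴸ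

candidates₅ : List (Vec ℕ 5)
candidates₅ = (2 ∷ 2 ∷ 2 ∷ 2 ∷ 2 ∷ []) ∷ᴸ (3 ∷ 2 ∷ 2 ∷ 2 ∷ 1 ∷ [])
           ∷ᴸ (3 ∷ 3 ∷ 2 ∷ 1 ∷ 1 ∷ []) ∷ᴸ (4 ∷ 2 ∷ 2 ∷ 1 ∷ 1 ∷ []) ∷ᴸ []ᴸ

lemma3p1 : (∀ (D : Vec ℕ 3) → NonIncreasing D → ForciblyUnicyclic D →
    D ≡ 2 ∷ 2 ∷ 2 ∷ [])
    × (∀ (D : Vec ℕ 4) → NonIncreasing D → ForciblyUnicyclic D →
    (D ≡ 2 ∷ 2 ∷ 2 ∷ 2 ∷ []) ⊎ (D ≡ 3 ∷ 2 ∷ 2 ∷ 1 ∷ []))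
    × (∀ (D : Vec ℕ 5) → NonIncreasing D → ForciblyUnicyclic D →
    (D ≡ 2 ∷ 2 ∷ 2 ∷ 2 ∷ 2 ∷ [])
    ⊎ (D ≡ 3 ∷ 2 ∷ 2 ∷ 2 ∷ 1 ∷ [])
    ⊎ (D ≡ 3 ∷ 3 ∷ 2 ∷ 1 ∷ 1 ∷ [])
    ⊎ (D ≡ 4 ∷ 2 ∷ 2 ∷ 1 ∷ 1 ∷ []))
lemma3p1 =
    (λ D ni fu → case₃ (forciblyUnicyclic⇒∈ candidates₃ unicyclic₃ D ni fu))
  , (λ D ni fu → case₄ (forciblyUnicyclic⇒∈ candidates₄ unicyclic₄ D ni fu))
  , (λ D ni fu → case₅ (forciblyUnicyclic⇒∈ candidates₅ unicyclic₅ D ni fu))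
  where
    unicyclic₃ : ∀ G → UnicyclicDegreesIn candidates₃ G
    unicyclic₃ = ∀-Graph (unicyclicDegreesIn? candidates₃) (UnicyclicDegreesIn-cong candidates₃)

    unicyclic₄ : ∀ G → UnicyclicDegreesIn candidates₄ G
    unicyclic₄ = ∀-Graph (unicyclicDegreesIn? candidates₄) (UnicyclicDegreesIn-cong candidates₄)

    unicyclic₅ : ∀ G → UnicyclicDegreesIn candidates₅ G
    unicyclic₅ = ∀-Graph (unicyclicDegreesIn? candidates₅) (UnicyclicDegreesIn-cong candidates₅)

    variable
      A : Set
      x a b c d : A

    case₃ : x ∈ a ∷ᴸ []ᴸ → x ≡ a
    case₃ (here x≡a) = x≡a

    case₄ : x ∈ a ∷ᴸ b ∷ᴸ []ᴸ → x ≡ a ⊎ x ≡ b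
    case₄ (here x≡a)         = inj₁ x≡a
    case₄ (there (here x≡b)) = inj₂ x≡b

    case₅ : x ∈ a ∷ᴸ b ∷ᴸ c ∷ᴸ d ∷ᴸ []ᴸ → x ≡ a ⊎ x ≡ b ⊎ x ≡ c ⊎ x ≡ d
    case₅ (here x≡a)                         = inj₁ x≡a
    case₅ (there (here x≡b))                 = inj₂ (inj₁ x≡b)
    case₅ (there (there (here x≡c)))         = inj₂ (inj₂ (inj₁ x≡c))
    case₅ (there (there (there (here x≡d)))) = inj₂ (inj₂ (inj₂ x≡d))
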